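{- For every nested sequent $\Gamma$: $\Gamma$ is provable in $\mathsf{GLP_{NS}}+\mathsf{cut}$ if and only if the formula $\Gamma^\sharp$ is provable in the Hilbert-style logic $\mathsf{GLP}$.
   Context: Formulas are built from propositional atoms $p$ and their complements $\overline{p}$, the constants $\top,\bot$, the connectives $\wedge,\vee$, and modalities $\Box_i,\Diamond_i$ for each natural number $i$. Negation $\overline{A}$ is defined by $\overline{(p)}=\overline{p}$, $\overline{\overline{p}}=p$, $\overline{\top}=\bot$, $\overline{\bot}=\top$, $\overline{A\wedge B}=\overline{A}\vee\overline{B}$, $\overline{A\vee B}=\overline{A}\wedge\overline{B}$, $\overline{\Box_iA}=\Diamond_i\overline{A}$, $\overline{\Diamond_iA}=\Box_i\overline{A}$; $A\to B:=\overline{A}\vee B$. The logic $\mathsf{GLP}$ has axioms: all Boolean tautologies; $\Box_i(A\to B)\to(\Box_iA\to\Box_iB)$; $\Box_i(\Box_iA\to A)\to\Box_iA$; $\Diamond_iA\to\Box_j\Diamond_iA$ for $i<j$; $\Box_iA\to\Box_jA$ for $i\le j$; and rules modus ponens and $A/\Box_iA$. A nested sequent is (inductively) a finite multiset of formulas and of expressions $[\Delta]_i$ with $\Delta$ a nested sequent and $i\in\mathbb{N}$. For $\Gamma=A_1,\dots,A_n,[\Delta_1]_{i_1},\dots,[\Delta_m]_{i_m}$, $\Gamma^\sharp:=\bot$ if $n=m=0$, and otherwise $\Gamma^\sharp:=A_1\vee\dots\vee A_n\vee\Box_{i_1}\Delta_1^\sharp\vee\dots\vee\Box_{i_m}\Delta_m^\sharp$.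 A unary context $\Gamma\{\ \}$ is a nested sequent with one hole in place of a formula; $\Gamma\{\Upsilon\}$ fills the hole with $\Upsilon$, $\Gamma\{\emptyset\}$ with the empty sequent. The calculus $\mathsf{GLP_{NS}}$ has initial sequents $\Gamma\{p,\overline{p}\}$, $\Gamma\{\top\}$ and rules (premises / conclusion): $\Gamma\{A\}$, $\Gamma\{B\}$ / $\Gamma\{A\wedge B\}$; $\Gamma\{A,B\}$ / $\Gamma\{A\vee B\}$; $\Gamma\{[A,\Diamond_i\overline{A}]_i\}$ / $\Gamma\{\Box_iA\}$; $\Gamma\{\Diamond_iA,[A,\Delta]_j\}$ / $\Gamma\{\Diamond_iA,[\Delta]_j\}$ ($i\le j$); $\Gamma\{\Diamond_iA,[\Diamond_iA,\Delta]_j\}$ / $\Gamma\{\Diamond_iA,[\Delta]_j\}$ ($i\le j$); $\Gamma\{\Diamond_iA,[\Diamond_iA,\Delta]_j\}$ / $\Gamma\{[\Diamond_iA,\Delta]_j\}$ ($i<j$). $\mathsf{GLP_{NS}}+\mathsf{cut}$ adds the rule $\Gamma\{A\}$, $\Gamma\{\overline{A}\}$ / $\Gamma\{\emptyset\}$. Provability means existence of a finite derivation tree whose leaves are initial sequents. -}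

module Defs where

open import Data.Nat using (ℕ; _≤_; _<_)
open import Data.Bool using (Bool; true; false; not; _∧_; _∨_)
open import Data.List using (List; []; _∷_; _++_)
open import Relation.Binary.PropositionalEquality using (_≡_)

-- Formulas (negation normal form); atoms are natural numbers

data Fm : Set where
  at    : ℕ → Fm
  nat   : ℕ → Fm
  ⊤'    : Fm
  ⊥'    : Fm
  _∧'_  : Fm → Fm → Fm
  _∨'_  : Fm → Fm → Fm
  □     : ℕ → Fm → Fm
  ◇     : ℕ → Fm → Fm

infixr 6 _∧'_
infixr 5 _∨'_
infixr 4 _⇒_

neg : Fm → Fm
neg (at p)    = nat p
neg (nat p)   = at p
neg ⊤'        = ⊥'
neg ⊥'        = ⊤'
neg (A ∧' B)  = neg A ∨' neg B
neg (A ∨' B)  = neg A ∧' neg B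
neg (□ i A)   = ◇ i (neg A)
neg (◇ i A)   = □ i (neg A)

_⇒_ : Fm → Fm → Fm
A ⇒ B = neg A ∨' B

-- Boolean tautologies: formulas true under every Boolean valuation that
-- treats the modal formulas □ᵢ B as propositional atoms (and ◇ᵢ B as the
-- Boolean negation of the atom □ᵢ B̄).

eval : (ℕ → Bool) → (ℕ → Fm → Bool) → Fm → Bool
eval v w (at p)   = v p
eval v w (nat p)  = not (v p)
eval v w ⊤'       = true
eval v w ⊥'       = false
eval v w (A ∧' B) = eval v w A ∧ eval v w B
eval v w (A ∨' B) = eval v w A ∨ eval v w B
eval v w (□ i A)  = w i A
eval v w (◇ i A)  = not (w i (neg A))

Tautology : Fm → Set
Tautology A = ∀ (v : ℕ → Bool) (w : ℕ → Fm → Bool) → eval v w A ≡ true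

data GLP⊢_ : Fm → Set where
  taut : ∀ {A} → Tautology A → GLP⊢ A
  axK  : ∀ {i A B} → GLP⊢ (□ i (A ⇒ B) ⇒ (□ i A ⇒ □ i B))
  axL  : ∀ {i A} → GLP⊢ (□ i (□ i A ⇒ A) ⇒ □ i A)
  ax◇  : ∀ {i j A} → i < j → GLP⊢ (◇ i A ⇒ □ j (◇ i A))
  ax□  : ∀ {i j A} → i ≤ j → GLP⊢ (□ i A ⇒ □ j A)
  mp   : ∀ {A B} → GLP⊢ A → GLP⊢ (A ⇒ B) → GLP⊢ B
  nec  : ∀ {i A} → GLP⊢ A → GLP⊢ □ i A

-- Nested sequents. A nested sequent is represented by a list of items;
-- it is read as a multiset, see _≈_ below.

data Item : Set where
  fm  : Fm → Item
  box : ℕ → List Item → Item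

NSeq : Set
NSeq = List Item

mutual
  ♯ : NSeq → Fm
  ♯ []            = ⊥'
  ♯ (x ∷ [])      = ♯ᵢ x
  ♯ (x ∷ y ∷ xs)  = ♯ᵢ x ∨' ♯ (y ∷ xs)

  ♯ᵢ : Item → Fm
  ♯ᵢ (fm A)    = A
  ♯ᵢ (box i Δ) = □ i (♯ Δ)

mutual
  data _≈ᵢ_ : Item → Item → Set where
    fm≈  : ∀ {A} → fm A ≈ᵢ fm A
    box≈ : ∀ {i Δ Δ'} → Δ ≈ Δ' → box i Δ ≈ᵢ box i Δ'

  data _≈_ : NSeq → NSeq → Set where
    nil≈   : [] ≈ []
    cons≈  : ∀ {x y xs ys} → x ≈ᵢ y → xs ≈ ys → (x ∷ xs) ≈ (y ∷ ys)
    swap≈  : ∀ {x y xs} → (x ∷ y ∷ xs) ≈ (y ∷ x ∷ xs)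
    trans≈ : ∀ {xs ys zs} → xs ≈ ys → ys ≈ zs → xs ≈ zs

-- Unary contexts Γ{ }: the hole sits at some nesting depth; since
-- sequents are multisets, the position within a level is irrelevant.
data Ctx : Set where
  here  : NSeq → Ctx
  there : NSeq → ℕ → Ctx → Ctx

_⟦_⟧ : Ctx → NSeq → NSeq
here Δ      ⟦ Υ ⟧ = Υ ++ Δ
there Δ i C ⟦ Υ ⟧ = box i (C ⟦ Υ ⟧) ∷ Δ

data NS[_]⊢_ (c : Bool) : NSeq → Set where
  exch  : ∀ {Γ Γ'} → Γ ≈ Γ' → NS[ c ]⊢ Γ → NS[ c ]⊢ Γ'
  idax  : ∀ C p → NS[ c ]⊢ (C ⟦ fm (at p) ∷ fm (nat p) ∷ [] ⟧)
  topax : ∀ C → NS[ c ]⊢ (C ⟦ fm ⊤' ∷ [] ⟧)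
  ∧r    : ∀ C {A B} → NS[ c ]⊢ (C ⟦ fm A ∷ [] ⟧) → NS[ c ]⊢ (C ⟦ fm B ∷ [] ⟧)
          → NS[ c ]⊢ (C ⟦ fm (A ∧' B) ∷ [] ⟧)
  ∨r    : ∀ C {A B} → NS[ c ]⊢ (C ⟦ fm A ∷ fm B ∷ [] ⟧)
          → NS[ c ]⊢ (C ⟦ fm (A ∨' B) ∷ [] ⟧)
  □r    : ∀ C {i A} → NS[ c ]⊢ (C ⟦ box i (fm A ∷ fm (◇ i (neg A)) ∷ []) ∷ [] ⟧)
          → NS[ c ]⊢ (C ⟦ fm (□ i A) ∷ [] ⟧)
  ◇r₁   : ∀ C {i j A Δ} → i ≤ j
          → NS[ c ]⊢ (C ⟦ fm (◇ i A) ∷ box j (fm A ∷ Δ) ∷ [] ⟧)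
          → NS[ c ]⊢ (C ⟦ fm (◇ i A) ∷ box j Δ ∷ [] ⟧)
  ◇r₂   : ∀ C {i j A Δ} → i ≤ j
          → NS[ c ]⊢ (C ⟦ fm (◇ i A) ∷ box j (fm (◇ i A) ∷ Δ) ∷ [] ⟧)
          → NS[ c ]⊢ (C ⟦ fm (◇ i A) ∷ box j Δ ∷ [] ⟧)
  ◇r₃   : ∀ C {i j A Δ} → i < j
          → NS[ c ]⊢ (C ⟦ fm (◇ i A) ∷ box j (fm (◇ i A) ∷ Δ) ∷ [] ⟧)
          → NS[ c ]⊢ (C ⟦ box j (fm (◇ i A) ∷ Δ) ∷ [] ⟧)
  cut   : ∀ C {A} → c ≡ true
          → NS[ c ]⊢ (C ⟦ fm A ∷ [] ⟧) → NS[ c ]⊢ (C ⟦ fm (neg A) ∷ [] ⟧)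
          → NS[ c ]⊢ (C ⟦ [] ⟧)

GLPNS+cut⊢_ : NSeq → Set
GLPNS+cut⊢ Γ = NS[ true ]⊢ Γ

module Submission where

-- Soundness.  Read
-- through ♯, every rule of the calculus is a GLP-provable implication from its
-- premises to its conclusion (Löb's axiom for the □-rule; monotonicity,
-- transitivity and ◇-export for the ◇-rules), and the context lemma `ctx⇛`
-- shows that provable rules stay provable inside any context Γ{ }.
--
-- Completeness.  Every GLP-theorem A is derivable everywhere: A can be added
-- to any sequent in any context.  The modal axioms and necessitation have short
-- derivations built on a generalised identity lemma, modus ponens is a cut, and
-- a tautology is decomposed by the invertible ∧/∨-rules into sequents of
-- literals, each of which contains a complementary pair because otherwise it
-- has a countermodel.  Finally Γ follows from Γ♯ by a cut against the sequent
-- (Γ♯)‾, Γ, which is derivable for every Γ.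

open import Defs
open import Function.Base using (id; _∘_; _$_)
open import Function.Bundles using (_⇔_; mk⇔; Equivalence)
open import Data.Nat using (ℕ; _≤_; _<_)
open import Data.Nat.Properties as ℕ using (≤-refl)
open import Data.Bool using (Bool; true; false; not; _∧_; _∨_; T)
open import Data.Bool.Properties using (T-≡; T-∨; T-∧; not-involutive; T?)
open import Data.List using (List; []; _∷_; _++_; map)
open import Data.List.Properties using (map-∘; ++-assoc; ++-identityʳ)
open import Data.List.Relation.Unary.All as All using (All; []; _∷_)
open import Data.List.Relation.Unary.All.Properties using (map⁺; map⁻)
open import Data.List.Relation.Unary.Any using (Any; here; there)
open import Data.List.Membership.Propositional using (_∈_; find)
open import Data.List.Membership.Propositional.Properties using (∈-∃++)
open import Data.List.Relation.Binary.Permutation.Propositional using (_↭_; refl; prep; swap; trans; ↭-sym)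
open import Data.List.Relation.Binary.Permutation.Propositional.Properties as ↭ using (shift; ∈-resp-↭)
open import Data.Product as Product using (_×_; _,_; proj₁; proj₂; ∃; ∃₂)
open import Data.Sum as Sum using (_⊎_; inj₁; inj₂; [_,_])
open import Data.Empty using (⊥; ⊥-elim)
open import Relation.Nullary using (¬_; Dec; yes; no)
open import Relation.Nullary.Decidable using (map′; _×-dec_; isYes; toWitness)
open import Relation.Binary.Definitions using (DecidableEquality)
open import Relation.Binary.PropositionalEquality using (_≡_; _≢_; refl; sym; cong; cong₂; subst) renaming (trans to _■_)

open Equivalence using (to; from)

neg-involutive : ∀ A → neg (neg A) ≡ A
neg-involutive (at p)   = refl
neg-involutive (nat p)  = refl
neg-involutive ⊤'       = refl
neg-involutive ⊥'       = refl
neg-involutive (A ∧' B) = cong₂ _∧'_ (neg-involutive A) (neg-involutive B)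
neg-involutive (A ∨' B) = cong₂ _∨'_ (neg-involutive A) (neg-involutive B)
neg-involutive (□ i A)  = cong (□ i) (neg-involutive A)
neg-involutive (◇ i A)  = cong (◇ i) (neg-involutive A)

eval-neg : ∀ v w A → eval v w (neg A) ≡ not (eval v w A)
eval-neg v w (at p)   = refl
eval-neg v w (nat p)  = sym (not-involutive (v p))
eval-neg v w ⊤'       = refl
eval-neg v w ⊥'       = refl
eval-neg v w (A ∧' B) rewrite eval-neg v w A | eval-neg v w B = de-morgan (eval v w A) _
  where
  de-morgan : ∀ a b → not a ∨ not b ≡ not (a ∧ b)
  de-morgan true  b = refl
  de-morgan false b = refl
eval-neg v w (A ∨' B) rewrite eval-neg v w A | eval-neg v w B = de-morgan (eval v w A) _
  where
  de-morgan : ∀ a b → not a ∧ not b ≡ not (a ∨ b)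
  de-morgan true  b = refl
  de-morgan false b = refl
eval-neg v w (□ i A)  rewrite neg-involutive A = refl
eval-neg v w (◇ i A)  = sym (not-involutive _)

-- A valuation interprets atoms and, independently, every boxed formula;
-- ρ ⊨ A says that A evaluates to true.  (It is a record so that A can be
-- inferred from ρ ⊨ A.)

Valuation : Set
Valuation = (ℕ → Bool) × (ℕ → Fm → Bool)

record _⊨_ (ρ : Valuation) (A : Fm) : Set where
  constructor holds
  field truth : T (eval (proj₁ ρ) (proj₂ ρ) A)

infix 3.5 _⊨_

⊨-tautology : ∀ {A} → Tautology A ⇔ (∀ ρ → ρ ⊨ A)
⊨-tautology = mk⇔ (λ taut-A (v , w) → holds (from T-≡ (taut-A v w)))
                  (λ ⊨A v w → to T-≡ (_⊨_.truth (⊨A (v , w))))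

⊨-∨ : ∀ {ρ A B} → ρ ⊨ A ∨' B ⇔ (ρ ⊨ A ⊎ ρ ⊨ B)
⊨-∨ = mk⇔ (λ (holds t) → Sum.map holds holds (to T-∨ t))
          (λ h → holds (from T-∨ (Sum.map _⊨_.truth _⊨_.truth h)))

⊨-∧ : ∀ {ρ A B} → ρ ⊨ A ∧' B ⇔ (ρ ⊨ A × ρ ⊨ B)
⊨-∧ = mk⇔ (λ (holds t) → Product.map holds holds (to T-∧ t))
          (λ h → holds (from T-∧ (Product.map _⊨_.truth _⊨_.truth h)))

⊨-neg : ∀ {ρ A} → ρ ⊨ neg A ⇔ (¬ ρ ⊨ A)
⊨-neg {v , w} {A} with eval v w A in eq
... | true  = mk⇔ (λ (holds t) _ → subst T (eval-neg v w A ■ cong not eq) t)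
                  (λ ⊭A → ⊥-elim (⊭A (holds (subst T (sym eq) _))))
... | false = mk⇔ (λ _ (holds t) → subst T eq t)
                  (λ _ → holds (subst T (sym (eval-neg v w A ■ cong not eq)) _))

excluded-middle : ∀ ρ A → ρ ⊨ A ⊎ ¬ ρ ⊨ A
excluded-middle (v , w) A with T? (eval v w A)
... | yes t = inj₁ (holds t)
... | no ¬t = inj₂ (λ (holds t) → ¬t t)

⊨-⇒ : ∀ {ρ A B} → ρ ⊨ A ⇒ B ⇔ (ρ ⊨ A → ρ ⊨ B)
⊨-⇒ {ρ} {A} =
  mk⇔ (λ ⊨A⇒B ⊨A → [ (λ ⊨Ā → ⊥-elim (to ⊨-neg ⊨Ā ⊨A)) , id ] (to ⊨-∨ ⊨A⇒B))
      (λ f → from ⊨-∨ (Sum.map (from ⊨-neg) f (Sum.swap (excluded-middle ρ A))))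

⊭⊥ : ∀ {ρ} → ¬ ρ ⊨ ⊥'
⊭⊥ (holds ())

⊨-♯∷ : ∀ {ρ} x Γ → ρ ⊨ ♯ (x ∷ Γ) ⇔ (ρ ⊨ ♯ᵢ x ⊎ ρ ⊨ ♯ Γ)
⊨-♯∷ x []      = mk⇔ inj₁ [ id , ⊥-elim ∘ ⊭⊥ ]
⊨-♯∷ x (y ∷ Γ) = ⊨-∨

⊨-♯++ : ∀ {ρ} Γ Δ → ρ ⊨ ♯ (Γ ++ Δ) ⇔ (ρ ⊨ ♯ Γ ⊎ ρ ⊨ ♯ Δ)
⊨-♯++ []      Δ = mk⇔ inj₂ [ ⊥-elim ∘ ⊭⊥ , id ]
⊨-♯++ (x ∷ Γ) Δ = mk⇔ split join
  where
  split : _ ⊨ ♯ (x ∷ Γ ++ Δ) → _ ⊨ ♯ (x ∷ Γ) ⊎ _ ⊨ ♯ Δ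
  split h with to (⊨-♯∷ x (Γ ++ Δ)) h
  ... | inj₁ ⊨x    = inj₁ (from (⊨-♯∷ x Γ) (inj₁ ⊨x))
  ... | inj₂ ⊨Γ++Δ = Sum.map₁ (from (⊨-♯∷ x Γ) ∘ inj₂) (to (⊨-♯++ Γ Δ) ⊨Γ++Δ)
  join : _ ⊨ ♯ (x ∷ Γ) ⊎ _ ⊨ ♯ Δ → _ ⊨ ♯ (x ∷ Γ ++ Δ)
  join (inj₁ ⊨xΓ) = from (⊨-♯∷ x (Γ ++ Δ))
                         (Sum.map₂ (from (⊨-♯++ Γ Δ) ∘ inj₁) (to (⊨-♯∷ x Γ) ⊨xΓ))
  join (inj₂ ⊨Δ)  = from (⊨-♯∷ x (Γ ++ Δ)) (inj₂ (from (⊨-♯++ Γ Δ) (inj₂ ⊨Δ)))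

-- Hs ⇛ G is the formula H₁ ⇒ (H₂ ⇒ … ⇒ G): the rule "from Hs infer G".

infixr 4 _⇛_

_⇛_ : List Fm → Fm → Fm
[]       ⇛ G = G
(H ∷ Hs) ⇛ G = H ⇒ (Hs ⇛ G)

⊨-⇛ : ∀ {ρ} Hs G → ρ ⊨ Hs ⇛ G ⇔ (All (ρ ⊨_) Hs → ρ ⊨ G)
⊨-⇛ []       G = mk⇔ (λ ⊨G _ → ⊨G) (λ f → f [])
⊨-⇛ (H ∷ Hs) G =
  mk⇔ (λ { ⊨rule (⊨H ∷ ⊨Hs) → to (⊨-⇛ Hs G) (to ⊨-⇒ ⊨rule ⊨H) ⊨Hs })
      (λ f → from ⊨-⇒ (λ ⊨H → from (⊨-⇛ Hs G) (λ ⊨Hs → f (⊨H ∷ ⊨Hs))))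

mp⇛ : ∀ {Hs G} → GLP⊢ (Hs ⇛ G) → All GLP⊢_ Hs → GLP⊢ G
mp⇛ ⊢G    []         = ⊢G
mp⇛ ⊢rule (⊢H ∷ ⊢Hs) = mp⇛ (mp ⊢H ⊢rule) ⊢Hs

tautological : ∀ {A} → (∀ ρ → ρ ⊨ A) → GLP⊢ A
tautological ⊨A = taut (from ⊨-tautology ⊨A)

by-semantics : ∀ Hs {G} → All GLP⊢_ Hs → (∀ ρ → All (ρ ⊨_) Hs → ρ ⊨ G) → GLP⊢ G
by-semantics Hs {G} ⊢Hs Hs⊨G = mp⇛ (tautological (λ ρ → from (⊨-⇛ Hs G) (Hs⊨G ρ))) ⊢Hs

⇒-refl : ∀ {A} → GLP⊢ (A ⇒ A)
⇒-refl = tautological (λ ρ → from ⊨-⇒ id)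

⇒-trans : ∀ {A B C} → GLP⊢ (A ⇒ B) → GLP⊢ (B ⇒ C) → GLP⊢ (A ⇒ C)
⇒-trans ⊢A⇒B ⊢B⇒C = by-semantics (_ ∷ _ ∷ []) (⊢A⇒B ∷ ⊢B⇒C ∷ [])
  (λ { ρ (A⇒B ∷ B⇒C ∷ []) → from ⊨-⇒ (to ⊨-⇒ B⇒C ∘ to ⊨-⇒ A⇒B) })

K⇛ : ∀ i Hs G → GLP⊢ (□ i (Hs ⇛ G) ⇒ (map (□ i) Hs ⇛ □ i G))
K⇛ i []       G = ⇒-refl
K⇛ i (H ∷ Hs) G = by-semantics (_ ∷ _ ∷ []) (axK ∷ K⇛ i Hs G ∷ [])
  (λ { ρ (K ∷ IH ∷ []) →
         from ⊨-⇒ (λ ⊨□rule → from ⊨-⇒ (to ⊨-⇒ IH ∘ to ⊨-⇒ (to ⊨-⇒ K ⊨□rule))) })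

□-mono⇛ : ∀ i Hs G → GLP⊢ (Hs ⇛ G) → GLP⊢ (map (□ i) Hs ⇛ □ i G)
□-mono⇛ i Hs G ⊢rule = mp (nec ⊢rule) (K⇛ i Hs G)

□-mono : ∀ i {A B} → GLP⊢ (A ⇒ B) → GLP⊢ (□ i A ⇒ □ i B)
□-mono i {A} {B} = □-mono⇛ i (A ∷ []) B

-- Transitivity □ᵢA ⇒ □ᵢ□ᵢA, derived from Löb's axiom for D = A ∧ □ᵢA.
four : ∀ i A → GLP⊢ (□ i A ⇒ □ i (□ i A))
four i A = ⇒-trans (□-mono i A⇒□D⇒D) (⇒-trans axL (□-mono i D⇒□A))
  where
  D = A ∧' □ i A
  D⇒A : GLP⊢ (D ⇒ A)
  D⇒A = tautological (λ ρ → from ⊨-⇒ (proj₁ ∘ to ⊨-∧))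
  D⇒□A : GLP⊢ (D ⇒ □ i A)
  D⇒□A = tautological (λ ρ → from ⊨-⇒ (proj₂ ∘ to ⊨-∧))
  A⇒□D⇒D : GLP⊢ (A ⇒ (□ i D ⇒ D))
  A⇒□D⇒D = by-semantics (_ ∷ []) (□-mono i D⇒A ∷ [])
    (λ { ρ (□D⇒□A ∷ []) →
           from ⊨-⇒ (λ ⊨A → from ⊨-⇒ (λ ⊨□D → from ⊨-∧ (⊨A , to ⊨-⇒ □D⇒□A ⊨□D))) })

∨-rule : ∀ {X Y : NSeq → Fm} D Υs Υ → (∀ {ρ} Π → ρ ⊨ Y Π ⇔ (ρ ⊨ X Π ⊎ ρ ⊨ D))
         → GLP⊢ (map X Υs ⇛ X Υ) → GLP⊢ (map Y Υs ⇛ Y Υ)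
∨-rule {X} {Y} D Υs Υ split ⊢rule = by-semantics (_ ∷ []) (⊢rule ∷ [])
  (λ { ρ (⊨rule ∷ []) → from (⊨-⇛ (map Y Υs) (Y Υ)) (λ ⊨Ys →
         from (split Υ) (Sum.map₁ (to (⊨-⇛ (map X Υs) (X Υ)) ⊨rule ∘ map⁺)
                                  (distrib (All.map (to (split _)) (map⁻ ⊨Ys))))) })
  where
  distrib : ∀ {P : NSeq → Set} {Q : Set} {Πs} → All (λ Π → P Π ⊎ Q) Πs → All P Πs ⊎ Q
  distrib []              = inj₁ []
  distrib (inj₁ p ∷ rest) = Sum.map₁ (p ∷_) (distrib rest)
  distrib (inj₂ q ∷ rest) = inj₂ q

ctx⇛ : ∀ C Υs Υ → GLP⊢ (map ♯ Υs ⇛ ♯ Υ)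
       → GLP⊢ (map (λ Π → ♯ (C ⟦ Π ⟧)) Υs ⇛ ♯ (C ⟦ Υ ⟧))
ctx⇛ (here Δ)      Υs Υ ⊢rule = ∨-rule (♯ Δ) Υs Υ (λ Π → ⊨-♯++ Π Δ) ⊢rule
ctx⇛ (there Δ i C) Υs Υ ⊢rule =
  ∨-rule (♯ Δ) Υs Υ (λ Π → ⊨-♯∷ (box i (C ⟦ Π ⟧)) Δ) ⊢□rule
  where
  ⊢□rule : GLP⊢ (map (λ Π → □ i (♯ (C ⟦ Π ⟧))) Υs ⇛ □ i (♯ (C ⟦ Υ ⟧)))
  ⊢□rule = subst (λ Hs → GLP⊢ (Hs ⇛ □ i (♯ (C ⟦ Υ ⟧)))) (sym (map-∘ Υs))
                 (□-mono⇛ i _ _ (ctx⇛ C Υs Υ ⊢rule))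

ctx-rule : ∀ C Υs Υ → GLP⊢ (map ♯ Υs ⇛ ♯ Υ)
           → All (λ Π → GLP⊢ ♯ (C ⟦ Π ⟧)) Υs → GLP⊢ ♯ (C ⟦ Υ ⟧)
ctx-rule C Υs Υ ⊢rule ⊢premises = mp⇛ (ctx⇛ C Υs Υ ⊢rule) (map⁺ ⊢premises)

mutual
  ≈ᵢ-sound : ∀ {x y} → x ≈ᵢ y → GLP⊢ (♯ᵢ x ⇒ ♯ᵢ y)
  ≈ᵢ-sound fm≈              = ⇒-refl
  ≈ᵢ-sound (box≈ {i} Δ≈Δ') = □-mono i (≈-sound Δ≈Δ')

  ≈-sound : ∀ {xs ys} → xs ≈ ys → GLP⊢ (♯ xs ⇒ ♯ ys)
  ≈-sound nil≈ = ⇒-refl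
  ≈-sound (cons≈ {x} {y} {xs} {ys} x≈y xs≈ys) =
    by-semantics (_ ∷ _ ∷ []) (≈ᵢ-sound x≈y ∷ ≈-sound xs≈ys ∷ [])
      (λ { ρ (x⇒y ∷ xs⇒ys ∷ []) →
             from ⊨-⇒ (from (⊨-♯∷ y ys) ∘ Sum.map (to ⊨-⇒ x⇒y) (to ⊨-⇒ xs⇒ys) ∘ to (⊨-♯∷ x xs)) })
  ≈-sound (swap≈ {x} {y} {xs}) = tautological (λ ρ → from ⊨-⇒ swapped)
    where
    swapped : ∀ {ρ} → ρ ⊨ ♯ (x ∷ y ∷ xs) → ρ ⊨ ♯ (y ∷ x ∷ xs)
    swapped h with to ⊨-∨ h
    ... | inj₁ ⊨x   = from ⊨-∨ (inj₂ (from (⊨-♯∷ x xs) (inj₁ ⊨x)))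
    ... | inj₂ ⊨yxs with to (⊨-♯∷ y xs) ⊨yxs
    ...   | inj₁ ⊨y  = from ⊨-∨ (inj₁ ⊨y)
    ...   | inj₂ ⊨xs = from ⊨-∨ (inj₂ (from (⊨-♯∷ x xs) (inj₂ ⊨xs)))
  ≈-sound (trans≈ p q) = ⇒-trans (≈-sound p) (≈-sound q)

excluded-middle-axiom : ∀ A → GLP⊢ (A ∨' neg A)
excluded-middle-axiom A =
  tautological (λ ρ → from ⊨-∨ (Sum.map₂ (from ⊨-neg) (excluded-middle ρ A)))

⊤-axiom : GLP⊢ ⊤'
⊤-axiom = tautological (λ ρ → holds _)

∧-rule : ∀ A B → GLP⊢ (A ∷ B ∷ [] ⇛ A ∧' B)
∧-rule A B = tautological (λ ρ → from (⊨-⇛ (A ∷ B ∷ []) _)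
  (λ { (⊨A ∷ ⊨B ∷ []) → from ⊨-∧ (⊨A , ⊨B) }))

cut-rule : ∀ A → GLP⊢ (A ∷ neg A ∷ [] ⇛ ⊥')
cut-rule A = tautological (λ ρ → from (⊨-⇛ (A ∷ neg A ∷ []) _)
  (λ { (⊨A ∷ ⊨Ā ∷ []) → ⊥-elim (to ⊨-neg ⊨Ā ⊨A) }))

-- The □-rule is Löb's axiom.
□-rule : ∀ i A → GLP⊢ (□ i (A ∨' ◇ i (neg A)) ⇒ □ i A)
□-rule i A = ⇒-trans (□-mono i commute) axL
  where
  commute : GLP⊢ (A ∨' ◇ i (neg A) ⇒ (□ i A ⇒ A))
  commute = tautological (λ ρ → from ⊨-⇒ (from ⊨-∨ ∘ Sum.swap ∘ to ⊨-∨))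

-- The first two ◇-rules: if □ᵢĀ forces □ⱼB and B refutes X, then a box
-- [X, Δ]ⱼ next to ◇ᵢA may drop X.
◇-absorb : ∀ {i j A B X} Δ → GLP⊢ (□ i (neg A) ⇒ □ j B) → (∀ {ρ} → ρ ⊨ B → ¬ ρ ⊨ X)
           → GLP⊢ (◇ i A ∨' □ j (♯ (fm X ∷ Δ)) ⇒ ◇ i A ∨' □ j (♯ Δ))
◇-absorb {i} {j} {A} {B} {X} Δ ⊢□Ā⇒□B B⊭X =
  by-semantics (_ ∷ _ ∷ []) (⊢□Ā⇒□B ∷ □-mono⇛ j (B ∷ ♯ (fm X ∷ Δ) ∷ []) (♯ Δ) drop-X ∷ [])
    (λ { ρ (□Ā⇒□B ∷ □drop-X ∷ []) →
           from ⊨-⇒ (absorb ρ (to ⊨-⇒ □Ā⇒□B) (to (⊨-⇛ (□ j B ∷ _ ∷ []) _) □drop-X) ∘ to ⊨-∨) })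
  where
  drop-X : GLP⊢ (B ∷ ♯ (fm X ∷ Δ) ∷ [] ⇛ ♯ Δ)
  drop-X = tautological (λ ρ → from (⊨-⇛ (B ∷ ♯ (fm X ∷ Δ) ∷ []) _)
    (λ { (⊨B ∷ ⊨XΔ ∷ []) → [ ⊥-elim ∘ B⊭X ⊨B , id ] (to (⊨-♯∷ (fm X) Δ) ⊨XΔ) }))
  absorb : ∀ ρ → (ρ ⊨ □ i (neg A) → ρ ⊨ □ j B)
           → (All (ρ ⊨_) (□ j B ∷ □ j (♯ (fm X ∷ Δ)) ∷ []) → ρ ⊨ □ j (♯ Δ))
           → ρ ⊨ ◇ i A ⊎ ρ ⊨ □ j (♯ (fm X ∷ Δ)) → ρ ⊨ ◇ i A ∨' □ j (♯ Δ)
  absorb ρ □Ā⇒□B □drop-X (inj₁ ⊨◇A) = from ⊨-∨ (inj₁ ⊨◇A)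
  absorb ρ □Ā⇒□B □drop-X (inj₂ ⊨□XΔ) with excluded-middle ρ (◇ i A)
  ... | inj₁ ⊨◇A = from ⊨-∨ (inj₁ ⊨◇A)
  ... | inj₂ ⊭◇A =
    from ⊨-∨ (inj₂ (□drop-X (□Ā⇒□B (from (⊨-neg {A = ◇ i A}) ⊭◇A) ∷ ⊨□XΔ ∷ [])))

-- The third ◇-rule is the axiom ◇ᵢA ⇒ □ⱼ◇ᵢA (i < j).
◇-export : ∀ {i j A} Δ → i < j
           → GLP⊢ (◇ i A ∨' □ j (♯ (fm (◇ i A) ∷ Δ)) ⇒ □ j (♯ (fm (◇ i A) ∷ Δ)))
◇-export {i} {j} {A} Δ i<j = by-semantics (_ ∷ _ ∷ []) (ax◇ i<j ∷ □-mono j weaken ∷ [])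
  (λ { ρ (◇⇒□◇ ∷ □◇⇒□◇Δ ∷ []) → from ⊨-⇒ ([ to ⊨-⇒ □◇⇒□◇Δ ∘ to ⊨-⇒ ◇⇒□◇ , id ] ∘ to ⊨-∨) })
  where
  weaken : GLP⊢ (◇ i A ⇒ ♯ (fm (◇ i A) ∷ Δ))
  weaken = tautological (λ ρ → from ⊨-⇒ (from (⊨-♯∷ (fm (◇ i A)) Δ) ∘ inj₁))

soundness : ∀ {Γ} → GLPNS+cut⊢ Γ → GLP⊢ ♯ Γ
soundness (exch Γ≈Γ' d)          = mp (soundness d) (≈-sound Γ≈Γ')
soundness (idax C p)             = ctx-rule C [] _ (excluded-middle-axiom (at p)) []
soundness (topax C)              = ctx-rule C [] _ ⊤-axiom []
soundness (∧r C {A} {B} d₁ d₂)   = ctx-rule C _ _ (∧-rule A B) (soundness d₁ ∷ soundness d₂ ∷ [])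
soundness (∨r C d)               = ctx-rule C _ _ ⇒-refl (soundness d ∷ [])
soundness (□r C {i} {A} d)       = ctx-rule C _ _ (□-rule i A) (soundness d ∷ [])
soundness (◇r₁ C {Δ = Δ} i≤j d)  =
  ctx-rule C _ _ (◇-absorb Δ (ax□ i≤j) (to ⊨-neg)) (soundness d ∷ [])
soundness (◇r₂ C {i} {A = A} {Δ} i≤j d) =
  ctx-rule C _ _ (◇-absorb Δ (⇒-trans (four i (neg A)) (ax□ i≤j)) (to (⊨-neg {A = ◇ i A})))
           (soundness d ∷ [])
soundness (◇r₃ C {Δ = Δ} i<j d)  = ctx-rule C _ _ (◇-export Δ i<j) (soundness d ∷ [])
soundness (cut C {A} refl d₁ d₂) = ctx-rule C _ _ (cut-rule A) (soundness d₁ ∷ soundness d₂ ∷ [])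

⊢_ : NSeq → Set
⊢ Γ = GLPNS+cut⊢ Γ

_∘ᶜ_ : Ctx → Ctx → Ctx
here Δ      ∘ᶜ here Δ'      = here (Δ' ++ Δ)
here Δ      ∘ᶜ there Δ' i D = there (Δ' ++ Δ) i D
there Δ i C ∘ᶜ D            = there Δ i (C ∘ᶜ D)

plug-∘ᶜ : ∀ C D Υ → (C ∘ᶜ D) ⟦ Υ ⟧ ≡ C ⟦ D ⟦ Υ ⟧ ⟧
plug-∘ᶜ (here Δ)      (here Δ')      Υ = sym (++-assoc Υ Δ' Δ)
plug-∘ᶜ (here Δ)      (there Δ' i D) Υ = refl
plug-∘ᶜ (there Δ i C) D              Υ = cong (λ Γ → box i Γ ∷ Δ) (plug-∘ᶜ C D Υ)

inside : ∀ C D {Υ} → ⊢ ((C ∘ᶜ D) ⟦ Υ ⟧) → ⊢ (C ⟦ D ⟦ Υ ⟧ ⟧)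
inside C D {Υ} = subst ⊢_ (plug-∘ᶜ C D Υ)

outside : ∀ C D {Υ} → ⊢ (C ⟦ D ⟦ Υ ⟧ ⟧) → ⊢ ((C ∘ᶜ D) ⟦ Υ ⟧)
outside C D {Υ} = subst ⊢_ (sym (plug-∘ᶜ C D Υ))

-- The context of the hole of a box [Υ]ᵢ standing next to Θ in C.
inner : Ctx → ℕ → NSeq → Ctx
inner C i Θ = C ∘ᶜ there Θ i (here [])

into-box : ∀ C i Θ {Υ} → ⊢ (inner C i Θ ⟦ Υ ⟧) → ⊢ (C ⟦ box i Υ ∷ Θ ⟧)
into-box C i Θ {Υ} =
  subst (λ Υ' → ⊢ (C ⟦ box i Υ' ∷ Θ ⟧)) (++-identityʳ Υ) ∘ inside C (there Θ i (here []))

mutual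
  ≈ᵢ-refl : ∀ {x} → x ≈ᵢ x
  ≈ᵢ-refl {fm A}    = fm≈
  ≈ᵢ-refl {box i Δ} = box≈ ≈-refl

  ≈-refl : ∀ {Γ} → Γ ≈ Γ
  ≈-refl {[]}    = nil≈
  ≈-refl {x ∷ Γ} = cons≈ ≈ᵢ-refl ≈-refl

↭⇒≈ : ∀ {Γ Γ'} → Γ ↭ Γ' → Γ ≈ Γ'
↭⇒≈ refl         = ≈-refl
↭⇒≈ (prep x σ)   = cons≈ ≈ᵢ-refl (↭⇒≈ σ)
↭⇒≈ (swap x y σ) = trans≈ swap≈ (cons≈ ≈ᵢ-refl (cons≈ ≈ᵢ-refl (↭⇒≈ σ)))
↭⇒≈ (trans σ σ') = trans≈ (↭⇒≈ σ) (↭⇒≈ σ')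

plug-↭ : ∀ C {Υ Υ'} → Υ ↭ Υ' → (C ⟦ Υ ⟧) ≈ (C ⟦ Υ' ⟧)
plug-↭ (here Δ)      σ = ↭⇒≈ (↭.++⁺ʳ Δ σ)
plug-↭ (there Δ i C) σ = cons≈ (box≈ (plug-↭ C σ)) ≈-refl

exchange : ∀ C {Υ Υ'} → Υ ↭ Υ' → ⊢ (C ⟦ Υ ⟧) → ⊢ (C ⟦ Υ' ⟧)
exchange C σ = exch (plug-↭ C σ)

swap² : ∀ {x y : Item} {Γ} → x ∷ y ∷ Γ ↭ y ∷ x ∷ Γ
swap² = swap _ _ refl

sink³ : ∀ {x y z : Item} {Γ} → x ∷ y ∷ z ∷ Γ ↭ y ∷ z ∷ x ∷ Γ
sink³ = trans swap² (prep _ swap²)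

reverse³ : ∀ {x y z : Item} {Γ} → x ∷ y ∷ z ∷ Γ ↭ z ∷ y ∷ x ∷ Γ
reverse³ = trans sink³ swap²

⊤r′ : ∀ C Θ → ⊢ (C ⟦ fm ⊤' ∷ Θ ⟧)
⊤r′ C Θ = inside C (here Θ) (topax (C ∘ᶜ here Θ))

idr′ : ∀ C Θ p → ⊢ (C ⟦ fm (at p) ∷ fm (nat p) ∷ Θ ⟧)
idr′ C Θ p = inside C (here Θ) (idax (C ∘ᶜ here Θ) p)

∧r′ : ∀ C Θ {A B} → ⊢ (C ⟦ fm A ∷ Θ ⟧) → ⊢ (C ⟦ fm B ∷ Θ ⟧) → ⊢ (C ⟦ fm (A ∧' B) ∷ Θ ⟧)
∧r′ C Θ d₁ d₂ =
  inside C (here Θ) (∧r (C ∘ᶜ here Θ) (outside C (here Θ) d₁) (outside C (here Θ) d₂))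

∨r′ : ∀ C Θ {A B} → ⊢ (C ⟦ fm A ∷ fm B ∷ Θ ⟧) → ⊢ (C ⟦ fm (A ∨' B) ∷ Θ ⟧)
∨r′ C Θ d = inside C (here Θ) (∨r (C ∘ᶜ here Θ) (outside C (here Θ) d))

□r′ : ∀ C Θ {i A} → ⊢ (C ⟦ box i (fm A ∷ fm (◇ i (neg A)) ∷ []) ∷ Θ ⟧)
      → ⊢ (C ⟦ fm (□ i A) ∷ Θ ⟧)
□r′ C Θ d = inside C (here Θ) (□r (C ∘ᶜ here Θ) (outside C (here Θ) d))

◇r′ : ∀ C Θ {i j A Δ} → i ≤ j → ⊢ (C ⟦ fm (◇ i A) ∷ box j (fm A ∷ Δ) ∷ Θ ⟧)
      → ⊢ (C ⟦ fm (◇ i A) ∷ box j Δ ∷ Θ ⟧)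
◇r′ C Θ i≤j d = inside C (here Θ) (◇r₁ (C ∘ᶜ here Θ) i≤j (outside C (here Θ) d))

◇r-export′ : ∀ C Θ {i j A Δ} → i < j → ⊢ (C ⟦ fm (◇ i A) ∷ box j (fm (◇ i A) ∷ Δ) ∷ Θ ⟧)
             → ⊢ (C ⟦ box j (fm (◇ i A) ∷ Δ) ∷ Θ ⟧)
◇r-export′ C Θ i<j d = inside C (here Θ) (◇r₃ (C ∘ᶜ here Θ) i<j (outside C (here Θ) d))

cut′ : ∀ C Θ A → ⊢ (C ⟦ fm A ∷ Θ ⟧) → ⊢ (C ⟦ fm (neg A) ∷ Θ ⟧) → ⊢ (C ⟦ Θ ⟧)
cut′ C Θ A d₁ d₂ =
  inside C (here Θ) (cut (C ∘ᶜ here Θ) refl (outside C (here Θ) d₁) (outside C (here Θ) d₂))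

-- The
-- modal cases open the box of the □-formula and let the ◇-formula place its
-- argument inside, where the induction hypothesis applies.
identity : ∀ A C Θ → ⊢ (C ⟦ fm (neg A) ∷ fm A ∷ Θ ⟧)
identity (at p)   C Θ = exchange C swap² (idr′ C Θ p)
identity (nat p)  C Θ = idr′ C Θ p
identity ⊤'       C Θ = exchange C swap² (⊤r′ C (fm ⊥' ∷ Θ))
identity ⊥'       C Θ = ⊤r′ C (fm ⊥' ∷ Θ)
identity (A ∧' B) C Θ =
  ∨r′ C _ $ exchange C sink³ $
  ∧r′ C _ (exchange C swap² (identity A C (fm (neg B) ∷ Θ)))
          (exchange C sink³ (identity B C (fm (neg A) ∷ Θ)))
identity (A ∨' B) C Θ =
  ∧r′ C _ (exchange C swap² $ ∨r′ C _ $ exchange C sink³ (identity A C (fm B ∷ Θ)))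
          (exchange C swap² $ ∨r′ C _ $ exchange C reverse³ (identity B C (fm A ∷ Θ)))
identity (□ i A)  C Θ =
  exchange C swap² $ □r′ C _ $ exchange C swap² $ ◇r′ C Θ ≤-refl $ exchange C swap² $
  into-box C i _ (identity A (inner C i (fm (◇ i (neg A)) ∷ Θ)) (fm (◇ i (neg A)) ∷ []))
identity (◇ i A)  C Θ =
  □r′ C _ $ subst (λ A′ → ⊢ (C ⟦ box i (fm (neg A) ∷ fm (◇ i A′) ∷ []) ∷ fm (◇ i A) ∷ Θ ⟧))
                  (sym (neg-involutive A)) $
  exchange C swap² $ ◇r′ C Θ ≤-refl $ exchange C swap² $
  into-box C i _ (exchange E swap² (identity A E (fm (◇ i A) ∷ [])))
  where E = inner C i (fm (◇ i A) ∷ Θ)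

-- Every sequent is derivable next to the negation of its interpretation; this
-- is what lets a cut on Γ♯ recover Γ.
mutual
  ♯-identity : ∀ Γ C → ⊢ (C ⟦ fm (neg (♯ Γ)) ∷ Γ ⟧)
  ♯-identity []          C = topax C
  ♯-identity (x ∷ [])    C = ♯ᵢ-identity x C
  ♯-identity (x ∷ y ∷ Γ) C =
    ∧r′ C (x ∷ y ∷ Γ) (inside C (here (y ∷ Γ)) (♯ᵢ-identity x (C ∘ᶜ here (y ∷ Γ))))
                      (exchange C (prep _ (↭-sym (↭.∷↭∷ʳ x (y ∷ Γ))))
                         (inside C (here (x ∷ [])) (♯-identity (y ∷ Γ) (C ∘ᶜ here (x ∷ [])))))

  ♯ᵢ-identity : ∀ x C → ⊢ (C ⟦ fm (neg (♯ᵢ x)) ∷ x ∷ [] ⟧)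
  ♯ᵢ-identity (fm A)    C = identity A C []
  ♯ᵢ-identity (box i Δ) C =
    ◇r′ C [] ≤-refl $ exchange C swap² $
    into-box C i _ (♯-identity Δ (inner C i (fm (◇ i (neg (♯ Δ))) ∷ [])))

Everywhere : Fm → Set
Everywhere A = ∀ C Θ → ⊢ (C ⟦ fm A ∷ Θ ⟧)

-- K: in the box [B, ◇ᵢB̄]ᵢ introduced for □ᵢB, the formulas ◇ᵢ(A⇒B)‾ and ◇ᵢĀ
-- deposit (A⇒B)‾ = Ā‾ ∧ B̄ and Ā, and both conjuncts close by identity.
K-everywhere : ∀ {i A B} → Everywhere (□ i (A ⇒ B) ⇒ (□ i A ⇒ □ i B))
K-everywhere {i} {A} {B} C Θ =
  ∨r′ C Θ $ exchange C swap² $ ∨r′ C _ $ exchange C swap² $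
  □r′ C _ $ exchange C swap² $ ◇r′ C _ ≤-refl $ exchange C reverse³ $
  ◇r′ C _ ≤-refl $ exchange C swap² $ into-box C i _ $
  ∧r′ E _ (identity (neg A) E _) (exchange E (prep _ swap²) (identity B E _))
  where E = inner C i (fm (◇ i (neg (A ⇒ B))) ∷ fm (◇ i (neg A)) ∷ Θ)

-- Löb: inside the box for □ᵢA, the deposited (□ᵢA ⇒ A)‾ = □ᵢĀ‾ ∧ Ā splits;
-- its first conjunct is closed one box deeper using the ◇ᵢĀ of that box.
Löb-everywhere : ∀ {i A} → Everywhere (□ i (□ i A ⇒ A) ⇒ □ i A)
Löb-everywhere {i} {A} C Θ =
  ∨r′ C Θ $ exchange C swap² $ □r′ C _ $ exchange C swap² $
  ◇r′ C Θ ≤-refl $ exchange C swap² $ into-box C i _ $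
  ∧r′ E _ (□r′ E _ $ exchange E sink³ $ ◇r′ E _ ≤-refl $ exchange E swap² $ into-box E i _ $
             exchange E′ swap² (identity (neg A) E′ _))
          (identity A E _)
  where
  E  = inner C i (fm (◇ i (neg (□ i A ⇒ A))) ∷ Θ)
  E′ = inner E i (fm (◇ i (neg A)) ∷ fm A ∷ [])

-- ◇ᵢA ⇒ □ⱼ◇ᵢA for i < j: the third ◇-rule moves ◇ᵢA out of the box for □ⱼ◇ᵢA.
◇-everywhere : ∀ {i j A} → i < j → Everywhere (◇ i A ⇒ □ j (◇ i A))
◇-everywhere {i} {j} {A} i<j C Θ =
  ∨r′ C Θ $ exchange C swap² $ □r′ C _ $ ◇r-export′ C _ i<j $
  exchange C sink³ (identity (◇ i A) C _)

-- □ᵢA ⇒ □ⱼA for i ≤ j: ◇ᵢĀ deposits Ā into the box for □ⱼA.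
□-everywhere : ∀ {i j A} → i ≤ j → Everywhere (□ i A ⇒ □ j A)
□-everywhere {i} {j} {A} i≤j C Θ =
  ∨r′ C Θ $ exchange C swap² $ □r′ C _ $ exchange C swap² $
  ◇r′ C Θ i≤j $ exchange C swap² $ into-box C j _ $
  identity A (inner C j (fm (◇ i (neg A)) ∷ Θ)) _

-- Modus ponens is a cut on A ⇒ B.
mp-everywhere : ∀ {A B} → Everywhere A → Everywhere (A ⇒ B) → Everywhere B
mp-everywhere {A} {B} ⊢A ⊢A⇒B C Θ =
  cut′ C (fm B ∷ Θ) (A ⇒ B) (⊢A⇒B C _)
       (∧r′ C _ (subst (λ A′ → ⊢ (C ⟦ fm A′ ∷ fm B ∷ Θ ⟧)) (sym (neg-involutive A)) (⊢A C _))
                (identity B C Θ))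

-- Necessitation: derive A inside the box introduced for □ᵢA.
nec-everywhere : ∀ {i A} → Everywhere A → Everywhere (□ i A)
nec-everywhere {i} {A} ⊢A C Θ = □r′ C Θ (into-box C i Θ (⊢A (inner C i Θ) _))

-- Decidable equality of formulas, needed to build countermodels.  Formulas
-- are first compared by their outermost constructor; Head t B unfolds B when
-- its outermost constructor has number t.

head : Fm → ℕ
head (at _)   = 0
head (nat _)  = 1
head ⊤'       = 2
head ⊥'       = 3
head (_ ∧' _) = 4
head (_ ∨' _) = 5
head (□ _ _)  = 6
head (◇ _ _)  = 7

Head : ℕ → Fm → Set
Head 0 B = ∃ λ q → B ≡ at q
Head 1 B = ∃ λ q → B ≡ nat q
Head 2 B = B ≡ ⊤'
Head 3 B = B ≡ ⊥'
Head 4 B = ∃₂ λ C D → B ≡ C ∧' D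
Head 5 B = ∃₂ λ C D → B ≡ C ∨' D
Head 6 B = ∃₂ λ j C → B ≡ □ j C
Head 7 B = ∃₂ λ j C → B ≡ ◇ j C
Head _ B = ⊥

unfold : ∀ B → Head (head B) B
unfold (at q)   = q , refl
unfold (nat q)  = q , refl
unfold ⊤'       = refl
unfold ⊥'       = refl
unfold (C ∧' D) = C , D , refl
unfold (C ∨' D) = C , D , refl
unfold (□ j C)  = j , C , refl
unfold (◇ j C)  = j , C , refl

dec₂ : ∀ {X Y Z : Set} {x x′ : X} {y y′ : Y} (f : X → Y → Z)
       → (f x y ≡ f x′ y′ → x ≡ x′ × y ≡ y′) → Dec (x ≡ x′) → Dec (y ≡ y′) → Dec (f x y ≡ f x′ y′)
dec₂ f injective x≟x′ y≟y′ =
  map′ (λ { (refl , refl) → refl }) injective (x≟x′ ×-dec y≟y′)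

mutual
  _≟_ : DecidableEquality Fm
  A ≟ B with head A ℕ.≟ head B
  ... | no heads≢  = no (heads≢ ∘ cong head)
  ... | yes heads≡ = same-head A (subst (λ t → Head t B) (sym heads≡) (unfold B))

  same-head : ∀ A {B} → Head (head A) B → Dec (A ≡ B)
  same-head (at p)   (q , refl)     = map′ (cong at) (λ { refl → refl }) (p ℕ.≟ q)
  same-head (nat p)  (q , refl)     = map′ (cong nat) (λ { refl → refl }) (p ℕ.≟ q)
  same-head ⊤'       refl           = yes refl
  same-head ⊥'       refl           = yes refl
  same-head (A ∧' B) (C , D , refl) = dec₂ _∧'_ (λ { refl → refl , refl }) (A ≟ C) (B ≟ D)
  same-head (A ∨' B) (C , D , refl) = dec₂ _∨'_ (λ { refl → refl , refl }) (A ≟ C) (B ≟ D)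
  same-head (□ i A)  (j , C , refl) = dec₂ □ (λ { refl → refl , refl }) (i ℕ.≟ j) (A ≟ C)
  same-head (◇ i A)  (j , C , refl) = dec₂ ◇ (λ { refl → refl , refl }) (i ℕ.≟ j) (A ≟ C)

open import Data.List.Membership.DecPropositional _≟_ using (_∈?_)

-- Literals are the formulas that the propositional rules do not decompose.
data Literal : Fm → Set where
  at  : ∀ p → Literal (at p)
  nat : ∀ p → Literal (nat p)
  ⊥'  : Literal ⊥'
  □   : ∀ i B → Literal (□ i B)
  ◇   : ∀ i B → Literal (◇ i B)

Valid : List Fm → Set
Valid Λ = ∀ ρ → Any (ρ ⊨_) Λ

complementary : ∀ C {A Λ} → A ∈ Λ → neg A ∈ Λ → A ≢ neg A → ⊢ (C ⟦ map fm Λ ⟧)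
complementary C {A} A∈Λ Ā∈Λ A≢Ā with ys , zs , refl ← ∈-∃++ A∈Λ
    with ∈-resp-↭ (shift A ys zs) Ā∈Λ
... | here Ā≡A = ⊥-elim (A≢Ā (sym Ā≡A))
... | there Ā∈rest with ys′ , zs′ , eq ← ∈-∃++ Ā∈rest =
  exchange C (↭.map⁺ fm (↭-sym Λ↭AĀrest)) (exchange C swap² (identity A C (map fm (ys′ ++ zs′))))
  where
  Λ↭AĀrest : ys ++ A ∷ zs ↭ A ∷ neg A ∷ ys′ ++ zs′
  Λ↭AĀrest = trans (shift A ys zs)
                   (prep A (subst (_↭ neg A ∷ ys′ ++ zs′) (sym eq) (shift (neg A) ys′ zs′)))

-- The valuation that makes every literal of Λ false, unless Λ contains its
-- negation.
countermodel : List Fm → Valuation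
countermodel Λ = (λ p → isYes (nat p ∈? Λ)) , (λ i B → isYes (◇ i (neg B) ∈? Λ))

-- A valid sequent of literals contains a complementary pair, since otherwise
-- the countermodel refutes it.
literals-complete : ∀ C Λ → All Literal Λ → Valid Λ → ⊢ (C ⟦ map fm Λ ⟧)
literals-complete C Λ literals valid
    with A , A∈Λ , ⊨A ← find (valid (countermodel Λ)) =
  from-true (All.lookup literals A∈Λ) A∈Λ ⊨A
  where
  refuted : ∀ {P : Set} (P? : Dec P) → T (not (isYes P?)) → ¬ P
  refuted (yes p) ()
  refuted (no ¬p) _ = ¬p
  from-true : ∀ {A} → Literal A → A ∈ Λ → countermodel Λ ⊨ A → ⊢ (C ⟦ map fm Λ ⟧)
  from-true (at p)  A∈Λ (holds t) = complementary C A∈Λ (toWitness {a? = nat p ∈? Λ} t) (λ ())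
  from-true (nat p) A∈Λ (holds t) = ⊥-elim (refuted (nat p ∈? Λ) t A∈Λ)
  from-true ⊥'      A∈Λ (holds ())
  from-true (□ i B) A∈Λ (holds t) =
    complementary C A∈Λ (toWitness {a? = ◇ i (neg B) ∈? Λ} t) (λ ())
  from-true (◇ i B) A∈Λ (holds t) =
    ⊥-elim (refuted (◇ i (neg (neg B)) ∈? Λ) t
                    (subst (λ B′ → ◇ i B′ ∈ Λ) (sym (neg-involutive B)) A∈Λ))

-- Each formula is decomposed by structural recursion,
-- using invertibility of ∧ and ∨; literals are moved into Λ.
Decomposable : List Fm → Set
Decomposable S = ∀ C Λ → All Literal Λ → Valid (S ++ Λ) → ⊢ (C ⟦ map fm (S ++ Λ) ⟧)

set-aside : ∀ {A} → Literal A → ∀ S → Decomposable S → Decomposable (A ∷ S)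
set-aside {A} literal S ⊢S C Λ literals valid =
  exchange C (↭.map⁺ fm (shift A S Λ))
    (⊢S C (A ∷ Λ) (literal ∷ literals) (↭.Any-resp-↭ (↭-sym (shift A S Λ)) ∘ valid))

decompose : ∀ A S → Decomposable S → Decomposable (A ∷ S)
decompose (at p)   S ⊢S = set-aside (at p) S ⊢S
decompose (nat p)  S ⊢S = set-aside (nat p) S ⊢S
decompose ⊥'       S ⊢S = set-aside ⊥' S ⊢S
decompose (□ i B)  S ⊢S = set-aside (□ i B) S ⊢S
decompose (◇ i B)  S ⊢S = set-aside (◇ i B) S ⊢S
decompose ⊤'       S ⊢S C Λ literals valid = ⊤r′ C _
decompose (A ∧' B) S ⊢S C Λ literals valid =
  ∧r′ C _ (decompose A S ⊢S C Λ literals (valid-∧ proj₁ ∘ valid))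
          (decompose B S ⊢S C Λ literals (valid-∧ proj₂ ∘ valid))
  where
  valid-∧ : ∀ {ρ X} → (ρ ⊨ A × ρ ⊨ B → ρ ⊨ X)
            → Any (ρ ⊨_) ((A ∧' B) ∷ S ++ Λ) → Any (ρ ⊨_) (X ∷ S ++ Λ)
  valid-∧ choose (here ⊨A∧B) = here (choose (to ⊨-∧ ⊨A∧B))
  valid-∧ choose (there rest) = there rest
decompose (A ∨' B) S ⊢S C Λ literals valid =
  ∨r′ C _ (decompose A (B ∷ S) (decompose B S ⊢S) C Λ literals (valid-∨ ∘ valid))
  where
  valid-∨ : ∀ {ρ} → Any (ρ ⊨_) ((A ∨' B) ∷ S ++ Λ) → Any (ρ ⊨_) (A ∷ B ∷ S ++ Λ)
  valid-∨ (here ⊨A∨B) with to ⊨-∨ ⊨A∨B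
  ... | inj₁ ⊨A = here ⊨A
  ... | inj₂ ⊨B = there (here ⊨B)
  valid-∨ (there rest) = there (there rest)

tautology-everywhere : ∀ {A} → Tautology A → Everywhere A
tautology-everywhere {A} taut-A C Θ =
  inside C (here Θ)
    (decompose A [] literals-complete (C ∘ᶜ here Θ) [] [] (λ ρ → here (to ⊨-tautology taut-A ρ)))

everywhere : ∀ {A} → GLP⊢ A → Everywhere A
everywhere (taut taut-A) = tautology-everywhere taut-A
everywhere axK           = K-everywhere
everywhere axL           = Löb-everywhere
everywhere (ax◇ i<j)     = ◇-everywhere i<j
everywhere (ax□ i≤j)     = □-everywhere i≤j
everywhere (mp ⊢A ⊢A⇒B)  = mp-everywhere (everywhere ⊢A) (everywhere ⊢A⇒B)
everywhere (nec ⊢A)      = nec-everywhere (everywhere ⊢A)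

-- Completeness: cut Γ♯ against its negation.
completeness : ∀ Γ → GLP⊢ ♯ Γ → GLPNS+cut⊢ Γ
completeness Γ ⊢Γ♯ = cut (here Γ) refl (everywhere ⊢Γ♯ (here Γ) [])
  (subst ⊢_ (++-identityʳ (fm (neg (♯ Γ)) ∷ Γ)) (♯-identity Γ (here [])))

proposition3 : ∀ (Γ : NSeq) → (GLPNS+cut⊢ Γ) ⇔ (GLP⊢ ♯ Γ)
proposition3 Γ = mk⇔ soundness (completeness Γ)
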